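{- For all $v\in\{a,b\}^*$, \[\left\lfloor\frac{\mathrm{ext}(v)}{2}\right\rfloor+1\le h(v)\le\left\lfloor\frac{|v|}{2}\right\rfloor+1.\] The lower bound is attained exactly by the words $v$ belonging, for some choice $\{x,y\}=\{a,b\}$, to $x^+(yx^+)^*$ when $\mathrm{ext}(v)$ is odd, and to $\{\varepsilon\}\cup x^+(yx^+)^*(y^+x)^*y^+$ when $\mathrm{ext}(v)$ is even. The upper bound is attained exactly by the words of $X=\{ab,ba\}^*\{\varepsilon,a,b\}\{ab,ba\}^*$.
   Context: For nonempty $v$ written uniquely as $x_0^{\alpha_0}\cdots x_n^{\alpha_n}$ (letters $x_i$, $\alpha_i\ge1$, $x_{i+1}\ne x_i$), $\mathrm{ext}(v)=n+1$ (number of runs); $\mathrm{ext}(\varepsilon)=0$. A word is constant if it is a power of one letter (including $\varepsilon$). For non-constant $u$, ${}_+u$ is the longest suffix of $u$ immediately preceded by the letter different from the first letter of $u$. Height: $v_{(1)}=v$, $v_{(n+1)}={}_+(v_{(n)})$ while $v_{(n)}$ is non-constant; $h(v)$ is the index $h$ such that $v_{(h)}$ is constant. -}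

module Defs where

open import Data.Nat.Base using (ℕ; zero; suc; _+_)
open import Data.List.Base using (List; []; _∷_; _++_; length)
open import Data.List.Relation.Unary.All as All using (All; []; _∷_; all?)
open import Data.Product.Base using (Σ; ∃; ∃₂; _×_; _,_)
open import Data.Sum.Base using (_⊎_)
open import Relation.Nullary using (Dec; yes; no; ¬_)
open import Relation.Binary.PropositionalEquality using (_≡_; _≢_; refl; sym; trans)

data Letter : Set where
  a b : Letter

_≟L_ : (x y : Letter) → Dec (x ≡ y)
a ≟L a = yes refl
a ≟L b = no λ ()
b ≟L a = no λ ()
b ≟L b = yes refl

Word : Set
Word = List Letter

-- ext v : number of runs (maximal blocks of equal letters); ext ε = 0
extAux : Letter → Word → ℕ
extAux p [] = 0
extAux p (y ∷ u) with y ≟L p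
... | yes _ = extAux y u
... | no  _ = suc (extAux y u)

ext : Word → ℕ
ext [] = 0
ext (x ∷ u) = suc (extAux x u)

Constant : Word → Set
Constant v = ∃ λ (x : Letter) → All (_≡ x) v

constant? : (v : Word) → Dec (Constant v)
constant? [] = yes (a , [])
constant? (x ∷ u) with all? (_≟L x) u
... | yes p = yes (x , (refl ∷ p))
... | no ¬p = no λ { (y , (q ∷ qs)) → ¬p (All.map (λ r → trans r (sym q)) qs) }

-- ₊u : for u = x^k y s (k ≥ 1, y ≠ x), ₊u = s, i.e. the longest suffix of u
-- immediately preceded by the letter different from the first letter of u.
-- (On constant words the value is irrelevant; we return ε.)
skipTo : Letter → Word → Word
skipTo x [] = []
skipTo x (y ∷ u) with y ≟L x
... | yes _ = skipTo x u
... | no  _ = u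

plus : Word → Word
plus [] = []
plus (x ∷ u) = skipTo x u

-- height with fuel: v₍₁₎ = v, v₍ₙ₊₁₎ = ₊(v₍ₙ₎) while v₍ₙ₎ non-constant;
-- h(v) = index h with v₍ₕ₎ constant.  Fuel |v| + 1 suffices since each ₊-step
-- shortens a non-constant word by at least 2.
heightF : ℕ → Word → ℕ
heightF zero v = 1
heightF (suc f) v with constant? v
... | yes _ = 1
... | no  _ = suc (heightF f (plus v))

height : Word → ℕ
height v = heightF (suc (length v)) v

Lang : Set₁
Lang = Word → Set

_·_ : Lang → Lang → Lang
(L · M) w = ∃₂ λ u v → w ≡ u ++ v × L u × M v

_∪_ : Lang → Lang → Lang
(L ∪ M) w = L w ⊎ M w

data Star (L : Lang) : Lang where
  nil  : Star L []
  cons : ∀ {u v} → L u → Star L v → Star L (u ++ v)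

Plus : Lang → Lang
Plus L = L · Star L

lit : Word → Lang
lit w u = u ≡ w

epsL : Lang
epsL = lit []

lett : Letter → Lang
lett x = lit (x ∷ [])

LowOdd : Letter → Letter → Lang
LowOdd x y = Plus (lett x) · Star (lett y · Plus (lett x))

LowEven : Letter → Letter → Lang
LowEven x y = epsL ∪ (((Plus (lett x) · Star (lett y · Plus (lett x)))
                        · Star (Plus (lett y) · lett x)) · Plus (lett y))

ABs : Lang
ABs = Star (lit (a ∷ b ∷ []) ∪ lit (b ∷ a ∷ []))

X : Lang
X = (ABs · (epsL ∪ (lett a ∪ lett b))) · ABs

-- Write a non-constant word as v = x^{k+1} y w with x ≠ y. Then ₊v = w, so h(v) = h(w) + 1,
-- while ext(v) = ext(yw) + 1 ≤ ext(w) + 2 and |v| ≥ |w| + 2; induction along the chain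
-- v, ₊v, ₊₊v, … gives both bounds. Equality in a bound holds for v iff it holds for w and
-- the step loses nothing: for the lower bound, w is empty or starts with x, or w starts with y
-- and ext(w) is odd (so that ⌊(ext(w) + 1)/2⌋ does not round down); for the upper bound,
-- k = 0, or k = 1 and |w| is even. These recursive conditions are right-linear grammars,
-- which are finally matched with the regular expressions of the statement.

module Submission where

open import Defs
open import Data.Nat.Base using (zero; suc; _+_; _≤_; _<_; z≤n; s≤s; ⌊_/2⌋; _%_)
open import Data.Nat.Properties
  using ( ≤-refl; ≤-reflexive; ≤-trans; n≤1+n; n<1+n; n≤0⇒n≡0; <-irrefl; +-comm; suc-injective
        ; ⌊n/2⌋-mono; module ≤-Reasoning )
open import Data.List.Base using ([]; _∷_; _++_; length; replicate)
open import Data.List.Properties using (length-++-≤ʳ; ++-identityʳ; ++-assoc; ∷-injectiveˡ; ∷-injectiveʳ)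
open import Data.List.Relation.Unary.All using (All; []; _∷_)
open import Data.Product.Base using (∃; ∃₂; _×_; _,_; proj₂)
open import Data.Product.Function.NonDependent.Propositional using (_×-⇔_)
open import Data.Sum.Base using (_⊎_; inj₁; inj₂; [_,_])
open import Data.Sum.Function.Propositional using (_⊎-⇔_)
open import Data.Empty using (⊥-elim)
open import Function.Base using (id; _∘_)
open import Function.Bundles using (_⇔_; mk⇔; Equivalence)
open import Function.Construct.Identity using (⇔-id)
open import Function.Construct.Symmetry using (⇔-sym)
open import Function.Construct.Composition using (_⇔-∘_)
open import Function.Related.Propositional using (module EquationalReasoning)
open import Relation.Nullary using (¬_; Dec; yes; no)
open import Relation.Binary.PropositionalEquality
  using (_≡_; _≢_; refl; sym; trans; cong; subst; ≢-sym; module ≡-Reasoning)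

two-letters : ∀ {x y : Letter} z → x ≢ y → z ≡ x ⊎ z ≡ y
two-letters {a} {a} _ x≢y = ⊥-elim (x≢y refl)
two-letters {b} {b} _ x≢y = ⊥-elim (x≢y refl)
two-letters {a} {b} a _   = inj₁ refl
two-letters {a} {b} b _   = inj₂ refl
two-letters {b} {a} a _   = inj₂ refl
two-letters {b} {a} b _   = inj₁ refl

another-letter : (x : Letter) → ∃ (x ≢_)
another-letter a = b , λ ()
another-letter b = a , λ ()

parity : ∀ n → n % 2 ≡ 0 ⊎ n % 2 ≡ 1
parity zero          = inj₁ refl
parity (suc zero)    = inj₂ refl
parity (suc (suc n)) = parity n

⌊1+n/2⌋-even : ∀ n → n % 2 ≡ 0 → ⌊ suc n /2⌋ ≡ ⌊ n /2⌋
⌊1+n/2⌋-even zero          _    = refl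
⌊1+n/2⌋-even (suc (suc n)) even = cong suc (⌊1+n/2⌋-even n even)

⌊1+n/2⌋-odd : ∀ n → n % 2 ≡ 1 → ⌊ suc n /2⌋ ≡ suc ⌊ n /2⌋
⌊1+n/2⌋-odd (suc zero)    _   = refl
⌊1+n/2⌋-odd (suc (suc n)) odd = cong suc (⌊1+n/2⌋-odd n odd)

suc-even : ∀ n → n % 2 ≡ 0 → suc n % 2 ≡ 1
suc-even zero          _    = refl
suc-even (suc (suc n)) even = suc-even n even

suc-odd : ∀ n → n % 2 ≡ 1 → suc n % 2 ≡ 0
suc-odd (suc zero)    _   = refl
suc-odd (suc (suc n)) odd = suc-odd n odd

suc-≡⇔ : ∀ {m m′ n n′} → m ≡ suc m′ → n ≡ suc n′ → (m ≡ n) ⇔ (m′ ≡ n′)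
suc-≡⇔ refl refl = mk⇔ suc-injective (cong suc)

≡⌊1+n/2⌋⇔odd : ∀ {h} n → suc ⌊ n /2⌋ ≤ h →
               (h ≡ ⌊ suc n /2⌋ ⇔ (n % 2 ≡ 1 × h ≡ suc ⌊ n /2⌋))
≡⌊1+n/2⌋⇔odd {h} n lower = mk⇔ to (λ (odd , h≡) → trans h≡ (sym (⌊1+n/2⌋-odd n odd)))
  where
  to : h ≡ ⌊ suc n /2⌋ → n % 2 ≡ 1 × h ≡ suc ⌊ n /2⌋
  to h≡ with parity n
  ... | inj₁ even = ⊥-elim (<-irrefl (sym (trans h≡ (⌊1+n/2⌋-even n even))) lower)
  ... | inj₂ odd  = odd , trans h≡ (⌊1+n/2⌋-odd n odd)

≡1+⌊1+n/2⌋⇔even : ∀ {h} n → h ≤ suc ⌊ n /2⌋ →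
                  (h ≡ suc ⌊ suc n /2⌋ ⇔ (n % 2 ≡ 0 × h ≡ suc ⌊ n /2⌋))
≡1+⌊1+n/2⌋⇔even {h} n upper =
  mk⇔ to (λ (even , h≡) → trans h≡ (cong suc (sym (⌊1+n/2⌋-even n even))))
  where
  to : h ≡ suc ⌊ suc n /2⌋ → n % 2 ≡ 0 × h ≡ suc ⌊ n /2⌋
  to h≡ with parity n
  ... | inj₁ even = even , trans h≡ (cong suc (⌊1+n/2⌋-even n even))
  ... | inj₂ odd  = ⊥-elim (<-irrefl (trans h≡ (cong suc (⌊1+n/2⌋-odd n odd))) (s≤s upper))

All≡⇒replicate : ∀ {x : Letter} u → All (_≡ x) u → u ≡ replicate (length u) x
All≡⇒replicate []      []           = refl
All≡⇒replicate (y ∷ u) (refl ∷ u≡x) = cong (y ∷_) (All≡⇒replicate u u≡x)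

++-∷ʳ-assoc : ∀ (r : Word) x s c → ((r ++ x ∷ []) ++ s) ++ c ≡ r ++ x ∷ (s ++ c)
++-∷ʳ-assoc r x s c = trans (++-assoc (r ++ x ∷ []) s c) (++-assoc r (x ∷ []) (s ++ c))

run≢peel : ∀ {x y : Letter} {w} j k → x ≢ y → replicate j x ≢ replicate k x ++ y ∷ w
run≢peel zero    zero    _   ()
run≢peel zero    (suc k) _   ()
run≢peel (suc j) zero    x≢y eq = x≢y (∷-injectiveˡ eq)
run≢peel (suc j) (suc k) x≢y eq = run≢peel j k x≢y (∷-injectiveʳ eq)

peel-injective : ∀ {x y : Letter} {w w′} j k → x ≢ y →
                 replicate j x ++ y ∷ w′ ≡ replicate k x ++ y ∷ w → w′ ≡ w
peel-injective zero    zero    _   eq = ∷-injectiveʳ eq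
peel-injective zero    (suc k) x≢y eq = ⊥-elim (x≢y (sym (∷-injectiveˡ eq)))
peel-injective (suc j) zero    x≢y eq = ⊥-elim (x≢y (∷-injectiveˡ eq))
peel-injective (suc j) (suc k) x≢y eq = peel-injective j k x≢y (∷-injectiveʳ eq)

length-y∷w<peel : ∀ {x y : Letter} k w → length (y ∷ w) < length (x ∷ replicate k x ++ y ∷ w)
length-y∷w<peel {y = y} k w = s≤s (length-++-≤ʳ (y ∷ w) {replicate k _})

length-w<peel : ∀ {x y : Letter} k w → length w < length (x ∷ replicate k x ++ y ∷ w)
length-w<peel k w = ≤-trans (n≤1+n _) (length-y∷w<peel k w)

-- The ₊-chain v, ₊v, ₊₊v, … down to a constant word: ₊(x^{k+1} y w) = w.
data Descent : Word → Set where
  constant : ∀ {v} → Constant v → Descent v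
  peel     : ∀ {x y w} k → x ≢ y → Descent w → Descent (x ∷ replicate k x ++ y ∷ w)

Descent-∷ : ∀ {x u} → Descent (x ∷ u) → Descent (x ∷ x ∷ u)
Descent-∷ (constant (c , x≡c ∷ u≡c)) = constant (c , x≡c ∷ x≡c ∷ u≡c)
Descent-∷ (peel k x≢y d)             = peel (suc k) x≢y d

descent : ∀ v → Descent v
descent []          = constant (a , [])
descent (x ∷ [])    = constant (x , refl ∷ [])
descent (x ∷ z ∷ u) = descent-∷∷ (z ≟L x) (descent (z ∷ u)) (descent u)
  where
  descent-∷∷ : Dec (z ≡ x) → Descent (z ∷ u) → Descent u → Descent (x ∷ z ∷ u)
  descent-∷∷ (yes refl) d _ = Descent-∷ d
  descent-∷∷ (no z≢x)   _ d = peel 0 (≢-sym z≢x) d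

¬Constant-peel : ∀ {x y} k w → x ≢ y → ¬ Constant (x ∷ replicate k x ++ y ∷ w)
¬Constant-peel {x} {y} k w x≢y (c , x≡c ∷ rest≡c) = x≢y (trans x≡c (sym (y≡c k rest≡c)))
  where
  y≡c : ∀ k → All (_≡ c) (replicate k x ++ y ∷ w) → y ≡ c
  y≡c zero    (p ∷ _)   = p
  y≡c (suc k) (_ ∷ all) = y≡c k all

plus-peel : ∀ {x y} k w → x ≢ y → plus (x ∷ replicate k x ++ y ∷ w) ≡ w
plus-peel {x} {y} k w x≢y = skipTo-peel k
  where
  skipTo-peel : ∀ k → skipTo x (replicate k x ++ y ∷ w) ≡ w
  skipTo-peel zero with y ≟L x
  ... | yes y≡x = ⊥-elim (x≢y (sym y≡x))
  ... | no _    = refl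
  skipTo-peel (suc k) with x ≟L x
  ... | yes _   = skipTo-peel k
  ... | no x≢x  = ⊥-elim (x≢x refl)

heightF-constant : ∀ f {v} → Constant v → heightF (suc f) v ≡ 1
heightF-constant f {v} c with constant? v
... | yes _ = refl
... | no ¬c = ⊥-elim (¬c c)

heightF-nonconstant : ∀ f {v} → ¬ Constant v → heightF (suc f) v ≡ suc (heightF f (plus v))
heightF-nonconstant f {v} ¬c with constant? v
... | yes c = ⊥-elim (¬c c)
... | no _  = refl

heightF-peel : ∀ f {x y} k w → x ≢ y →
               heightF (suc f) (x ∷ replicate k x ++ y ∷ w) ≡ suc (heightF f w)
heightF-peel f k w x≢y = trans (heightF-nonconstant f (¬Constant-peel k w x≢y))
                               (cong (λ u → suc (heightF f u)) (plus-peel k w x≢y))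

heightF-fuel-irrelevant : ∀ {f g v} → Descent v → length v < f → length v < g → heightF f v ≡ heightF g v
heightF-fuel-irrelevant {suc f} {suc g} (constant c) _ _ =
  trans (heightF-constant f c) (sym (heightF-constant g c))
heightF-fuel-irrelevant {suc f} {suc g} (peel {x} {y} {w} k x≢y d) (s≤s |v|≤f) (s≤s |v|≤g) = begin
  heightF (suc f) (x ∷ replicate k x ++ y ∷ w) ≡⟨ heightF-peel f k w x≢y ⟩
  suc (heightF f w)
    ≡⟨ cong suc (heightF-fuel-irrelevant d (shorter |v|≤f) (shorter |v|≤g)) ⟩
  suc (heightF g w)                            ≡⟨ sym (heightF-peel g k w x≢y) ⟩
  heightF (suc g) (x ∷ replicate k x ++ y ∷ w) ∎
  where
  open ≡-Reasoning
  shorter : ∀ {n} → length (x ∷ replicate k x ++ y ∷ w) ≤ n → length w < n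
  shorter = ≤-trans (length-w<peel k w)

height-constant : ∀ {v} → Constant v → height v ≡ 1
height-constant = heightF-constant _

height-peel : ∀ {x y} k {w} → x ≢ y → Descent w → height (x ∷ replicate k x ++ y ∷ w) ≡ suc (height w)
height-peel k {w} x≢y d =
  trans (heightF-peel _ k w x≢y) (cong suc (heightF-fuel-irrelevant d (length-w<peel k w) ≤-refl))

extAux-replicate : ∀ x k u → extAux x (replicate k x ++ u) ≡ extAux x u
extAux-replicate x zero    u = refl
extAux-replicate x (suc k) u with x ≟L x
... | yes _  = extAux-replicate x k u
... | no x≢x = ⊥-elim (x≢x refl)

ext-peel : ∀ {x y} k w → x ≢ y → ext (x ∷ replicate k x ++ y ∷ w) ≡ suc (ext (y ∷ w))
ext-peel {x} {y} k w x≢y = cong suc (trans (extAux-replicate x k (y ∷ w)) extAux-switch)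
  where
  extAux-switch : extAux x (y ∷ w) ≡ suc (extAux y w)
  extAux-switch with y ≟L x
  ... | yes y≡x = ⊥-elim (x≢y (sym y≡x))
  ... | no _    = refl

ext-∷∷ : ∀ y w → ext (y ∷ y ∷ w) ≡ ext (y ∷ w)
ext-∷∷ y w = cong suc (extAux-replicate y 1 w)

ext-∷ : ∀ y w → ext (y ∷ w) ≤ suc (ext w)
ext-∷ y []      = ≤-refl
ext-∷ y (z ∷ w) with z ≟L y
... | yes _ = n≤1+n _
... | no _  = ≤-refl

ext-run : ∀ x k → ext (x ∷ replicate k x) ≡ 1
ext-run x zero    = refl
ext-run x (suc k) = trans (ext-∷∷ x (replicate k x)) (ext-run x k)

ext-constant : ∀ {v} → Constant v → ext v ≤ 1
ext-constant {[]}    _                 = z≤n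
ext-constant {x ∷ u} (_ , refl ∷ u≡x) =
  ≤-reflexive (trans (cong (λ u → ext (x ∷ u)) (All≡⇒replicate u u≡x)) (ext-run x (length u)))

ext-alternate : ∀ {x y} k u → x ≢ y → ext (x ∷ replicate k x ++ y ∷ x ∷ u) ≡ suc (suc (ext (x ∷ u)))
ext-alternate k u x≢y = trans (ext-peel k (_ ∷ u) x≢y) (cong suc (ext-peel 0 u (≢-sym x≢y)))

height-lower : ∀ {v} → Descent v → suc ⌊ ext v /2⌋ ≤ height v
height-lower {v} (constant c) =
  subst (suc ⌊ ext v /2⌋ ≤_) (sym (height-constant c)) (s≤s (⌊n/2⌋-mono (ext-constant c)))
height-lower (peel {x} {y} {w} k x≢y d) = begin
  suc ⌊ ext (x ∷ replicate k x ++ y ∷ w) /2⌋ ≡⟨ cong (λ n → suc ⌊ n /2⌋) (ext-peel k w x≢y) ⟩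
  suc ⌊ suc (ext (y ∷ w)) /2⌋                ≤⟨ s≤s (⌊n/2⌋-mono (s≤s (ext-∷ y w))) ⟩
  suc (suc ⌊ ext w /2⌋)                      ≤⟨ s≤s (height-lower d) ⟩
  suc (height w)                             ≡⟨ sym (height-peel k x≢y d) ⟩
  height (x ∷ replicate k x ++ y ∷ w)        ∎
  where open ≤-Reasoning

height-upper : ∀ {v} → Descent v → height v ≤ suc ⌊ length v /2⌋
height-upper {v} (constant c) = subst (_≤ suc ⌊ length v /2⌋) (sym (height-constant c)) (s≤s z≤n)
height-upper (peel {x} {y} {w} k x≢y d) = begin
  height (x ∷ replicate k x ++ y ∷ w)        ≡⟨ height-peel k x≢y d ⟩
  suc (height w)                             ≤⟨ s≤s (height-upper d) ⟩
  suc ⌊ suc (suc (length w)) /2⌋             ≤⟨ s≤s (⌊n/2⌋-mono (length-y∷w<peel k w)) ⟩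
  suc ⌊ length (x ∷ replicate k x ++ y ∷ w) /2⌋ ∎
  where open ≤-Reasoning

-- Right-linear grammars for the lower-bound languages: LowOdd′ x y is x⁺(yx⁺)*, and
-- LowEven′ x y is x⁺(yx⁺)*(y⁺x)*y⁺ without ε, using (y⁺x)*y⁺ = y⁺(xy⁺)*.
data LowOdd′ (x y : Letter) : Word → Set where
  run  : ∀ k → LowOdd′ x y (x ∷ replicate k x)
  step : ∀ k {w} → LowOdd′ x y w → LowOdd′ x y (x ∷ replicate k x ++ y ∷ w)

data LowEven′ (x y : Letter) : Word → Set where
  switch : ∀ k {w} → LowOdd′ y x w → LowEven′ x y (x ∷ replicate k x ++ w)
  step   : ∀ k {w} → LowEven′ x y w → LowEven′ x y (x ∷ replicate k x ++ y ∷ w)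

Low : Letter → Letter → Word → Set
Low x y v = LowOdd′ x y v ⊎ LowEven′ x y v

Lower : Word → Set
Lower v = v ≡ [] ⊎ ∃₂ λ x y → x ≢ y × Low x y v

StartsWith : Letter → Word → Set
StartsWith x v = ∃ λ u → v ≡ x ∷ u

LowOdd′-start : ∀ {x y v} → LowOdd′ x y v → StartsWith x v
LowOdd′-start (run _)    = _ , refl
LowOdd′-start (step _ _) = _ , refl

LowEven′-start : ∀ {x y v} → LowEven′ x y v → StartsWith x v
LowEven′-start (switch _ _) = _ , refl
LowEven′-start (step _ _)   = _ , refl

Low-start : ∀ {x y v} → Low x y v → StartsWith x v
Low-start (inj₁ o) = LowOdd′-start o
Low-start (inj₂ e) = LowEven′-start e

module _ {x y : Letter} (x≢y : x ≢ y) where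

  LowOdd′-peel⁻ : ∀ {v} k {w} → LowOdd′ x y v → v ≡ x ∷ replicate k x ++ y ∷ w → LowOdd′ x y w
  LowOdd′-peel⁻ k (run j)    eq = ⊥-elim (run≢peel j k x≢y (∷-injectiveʳ eq))
  LowOdd′-peel⁻ k (step j o) eq with peel-injective j k x≢y (∷-injectiveʳ eq)
  ... | refl = o

  LowEven′-peel⁻ : ∀ {v} k {w} → LowEven′ x y v → v ≡ x ∷ replicate k x ++ y ∷ w →
                   LowEven′ x y w ⊎ LowOdd′ y x (y ∷ w)
  LowEven′-peel⁻ k (switch j o) eq with LowOdd′-start o
  ... | _ , refl with peel-injective j k x≢y (∷-injectiveʳ eq)
  ...   | refl = inj₂ o
  LowEven′-peel⁻ k (step j e) eq with peel-injective j k x≢y (∷-injectiveʳ eq)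
  ... | refl = inj₁ e

  Low-peel : ∀ k {w} → Low x y (x ∷ replicate k x ++ y ∷ w) ⇔ (Low x y w ⊎ LowOdd′ y x (y ∷ w))
  Low-peel k = mk⇔ to from
    where
    to : Low x y (x ∷ replicate k x ++ y ∷ _) → Low x y _ ⊎ LowOdd′ y x (y ∷ _)
    to (inj₁ o) = inj₁ (inj₁ (LowOdd′-peel⁻ k o refl))
    to (inj₂ e) with LowEven′-peel⁻ k e refl
    ... | inj₁ e′ = inj₁ (inj₂ e′)
    ... | inj₂ o  = inj₂ o
    from : Low x y _ ⊎ LowOdd′ y x (y ∷ _) → Low x y (x ∷ replicate k x ++ y ∷ _)
    from (inj₁ (inj₁ o)) = inj₁ (step k o)
    from (inj₁ (inj₂ e)) = inj₂ (step k e)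
    from (inj₂ o)        = inj₂ (switch k o)

  ¬Low-y∷ : ∀ {u} → ¬ Low x y (y ∷ u)
  ¬Low-y∷ l = x≢y (sym (∷-injectiveˡ (proj₂ (Low-start l))))

  Lower-∷ : ∀ {u} → Lower (x ∷ u) ⇔ Low x y (x ∷ u)
  Lower-∷ = mk⇔ to (λ l → inj₂ (x , y , x≢y , l))
    where
    to : Lower (x ∷ _) → Low x y (x ∷ _)
    to (inj₂ (x′ , y′ , x′≢y′ , l)) with Low-start l
    ... | _ , refl with two-letters y′ x≢y
    ...   | inj₁ refl = ⊥-elim (x′≢y′ refl)
    ...   | inj₂ refl = l

  LowOdd′-∷ : ∀ {u} → LowOdd′ x y (x ∷ x ∷ u) ⇔ LowOdd′ x y (x ∷ u)
  LowOdd′-∷ = mk⇔ (λ o → drop o refl) prepend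
    where
    prepend : ∀ {v} → LowOdd′ x y v → LowOdd′ x y (x ∷ v)
    prepend (run k)    = run (suc k)
    prepend (step k o) = step (suc k) o
    drop : ∀ {v u} → LowOdd′ x y v → v ≡ x ∷ x ∷ u → LowOdd′ x y (x ∷ u)
    drop (run (suc k))    refl = run k
    drop (step zero _)    eq   = ⊥-elim (x≢y (sym (∷-injectiveˡ (∷-injectiveʳ eq))))
    drop (step (suc k) o) refl = step k o

LowOdd′-odd : ∀ {x y v} → x ≢ y → LowOdd′ x y v → ext v % 2 ≡ 1
LowOdd′-odd {x} _ (run k) = cong (_% 2) (ext-run x k)
LowOdd′-odd x≢y (step k o) with LowOdd′-start o
... | u , refl = trans (cong (_% 2) (ext-alternate k u x≢y)) (LowOdd′-odd x≢y o)

LowEven′-even : ∀ {x y v} → x ≢ y → LowEven′ x y v → ext v % 2 ≡ 0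
LowEven′-even x≢y (switch k o) with LowOdd′-start o
... | u , refl = trans (cong (_% 2) (ext-peel k u x≢y)) (suc-odd (ext (_ ∷ u)) (LowOdd′-odd (≢-sym x≢y) o))
LowEven′-even x≢y (step k e) with LowEven′-start e
... | u , refl = trans (cong (_% 2) (ext-alternate k u x≢y)) (LowEven′-even x≢y e)

Low-odd : ∀ {x y v} → x ≢ y → (ext v % 2 ≡ 1 × Low x y v) ⇔ LowOdd′ x y v
Low-odd {x} {y} {v} x≢y = mk⇔ to (λ o → LowOdd′-odd x≢y o , inj₁ o)
  where
  to : ext v % 2 ≡ 1 × Low x y v → LowOdd′ x y v
  to (_   , inj₁ o) = o
  to (odd , inj₂ e) with trans (sym odd) (LowEven′-even x≢y e)
  ... | ()

AtLowerBound : Word → Set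
AtLowerBound v = height v ≡ suc ⌊ ext v /2⌋

AtLowerBound-constant : ∀ {v} → Constant v → AtLowerBound v
AtLowerBound-constant c =
  trans (height-constant c) (cong suc (sym (n≤0⇒n≡0 (⌊n/2⌋-mono (ext-constant c)))))

Lower-constant : ∀ {v} → Constant v → Lower v
Lower-constant {[]}    _                 = inj₁ refl
Lower-constant {x ∷ u} (_ , refl ∷ u≡x) with another-letter x
... | y , x≢y = inj₂ (x , y , x≢y , inj₁ (subst (λ u → LowOdd′ x y (x ∷ u))
                                                 (sym (All≡⇒replicate u u≡x)) (run (length u))))

AtLowerBound-peel : ∀ {x y} k {w} → x ≢ y → Descent w →
                    AtLowerBound (x ∷ replicate k x ++ y ∷ w) ⇔ (height w ≡ ⌊ suc (ext (y ∷ w)) /2⌋)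
AtLowerBound-peel k {w} x≢y d =
  suc-≡⇔ (height-peel k x≢y d) (cong (λ n → suc ⌊ n /2⌋) (ext-peel k w x≢y))

module _ {x y : Letter} (x≢y : x ≢ y) where
  open EquationalReasoning

  lower-tail-switch : ∀ {u} → Descent (x ∷ u) → (AtLowerBound (x ∷ u) ⇔ Lower (x ∷ u)) →
                      (height (x ∷ u) ≡ ⌊ suc (ext (y ∷ x ∷ u)) /2⌋)
                        ⇔ (Low x y (x ∷ u) ⊎ LowOdd′ y x (y ∷ x ∷ u))
  lower-tail-switch {u} d ih = begin
    height (x ∷ u) ≡ ⌊ suc (ext (y ∷ x ∷ u)) /2⌋
      ≡⟨ cong (λ n → height (x ∷ u) ≡ ⌊ suc n /2⌋) (ext-peel 0 u (≢-sym x≢y)) ⟩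
    AtLowerBound (x ∷ u)                           ∼⟨ ih ⟩
    Lower (x ∷ u)                                  ∼⟨ Lower-∷ x≢y ⟩
    Low x y (x ∷ u)                                ∼⟨ mk⇔ inj₁ [ id , absorb ] ⟩
    (Low x y (x ∷ u) ⊎ LowOdd′ y x (y ∷ x ∷ u))    ∎
    where
    absorb : LowOdd′ y x (y ∷ x ∷ u) → Low x y (x ∷ u)
    absorb o = inj₂ (switch 0 (LowOdd′-peel⁻ (≢-sym x≢y) 0 o refl))

  lower-tail-repeat : ∀ {u} → Descent (y ∷ u) → (AtLowerBound (y ∷ u) ⇔ Lower (y ∷ u)) →
                      (height (y ∷ u) ≡ ⌊ suc (ext (y ∷ y ∷ u)) /2⌋)
                        ⇔ (Low x y (y ∷ u) ⊎ LowOdd′ y x (y ∷ y ∷ u))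
  lower-tail-repeat {u} d ih = begin
    height (y ∷ u) ≡ ⌊ suc (ext (y ∷ y ∷ u)) /2⌋
      ≡⟨ cong (λ n → height (y ∷ u) ≡ ⌊ suc n /2⌋) (ext-∷∷ y u) ⟩
    height (y ∷ u) ≡ ⌊ suc (ext (y ∷ u)) /2⌋       ∼⟨ ≡⌊1+n/2⌋⇔odd (ext (y ∷ u)) (height-lower d) ⟩
    (ext (y ∷ u) % 2 ≡ 1 × AtLowerBound (y ∷ u))   ∼⟨ ⇔-id _ ×-⇔ (Lower-∷ (≢-sym x≢y) ⇔-∘ ih) ⟩
    (ext (y ∷ u) % 2 ≡ 1 × Low y x (y ∷ u))        ∼⟨ Low-odd (≢-sym x≢y) ⟩
    LowOdd′ y x (y ∷ u)                            ∼⟨ ⇔-sym (LowOdd′-∷ (≢-sym x≢y)) ⟩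
    LowOdd′ y x (y ∷ y ∷ u)                        ∼⟨ mk⇔ inj₂ [ ⊥-elim ∘ ¬Low-y∷ x≢y , id ] ⟩
    (Low x y (y ∷ u) ⊎ LowOdd′ y x (y ∷ y ∷ u))    ∎

  lower-tail : ∀ {w} → Descent w → (AtLowerBound w ⇔ Lower w) →
               (height w ≡ ⌊ suc (ext (y ∷ w)) /2⌋) ⇔ (Low x y w ⊎ LowOdd′ y x (y ∷ w))
  lower-tail {[]}    _ _ = mk⇔ (λ _ → inj₂ (run 0)) (λ _ → refl)
  lower-tail {z ∷ u} with two-letters z x≢y
  ... | inj₁ refl = lower-tail-switch
  ... | inj₂ refl = lower-tail-repeat

AtLowerBound⇔Lower : ∀ {v} → Descent v → AtLowerBound v ⇔ Lower v
AtLowerBound⇔Lower (constant c) = mk⇔ (λ _ → Lower-constant c) (λ _ → AtLowerBound-constant c)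
AtLowerBound⇔Lower (peel {x} {y} {w} k x≢y d) = begin
  AtLowerBound (x ∷ replicate k x ++ y ∷ w) ∼⟨ AtLowerBound-peel k x≢y d ⟩
  height w ≡ ⌊ suc (ext (y ∷ w)) /2⌋        ∼⟨ lower-tail x≢y d (AtLowerBound⇔Lower d) ⟩
  (Low x y w ⊎ LowOdd′ y x (y ∷ w))         ∼⟨ ⇔-sym (Low-peel x≢y k) ⟩
  Low x y (x ∷ replicate k x ++ y ∷ w)      ∼⟨ ⇔-sym (Lower-∷ x≢y) ⟩
  Lower (x ∷ replicate k x ++ y ∷ w)        ∎
  where open EquationalReasoning

data Pairs : Word → Set where
  []   : Pairs []
  pair : ∀ {x y w} → x ≢ y → Pairs w → Pairs (x ∷ y ∷ w)

data X′ : Word → Set where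
  pairs  : ∀ {w} → Pairs w → X′ w
  middle : ∀ c {w} → Pairs w → X′ (c ∷ w)
  pair   : ∀ {x y w} → x ≢ y → X′ w → X′ (x ∷ y ∷ w)

Pairs-even : ∀ {w} → Pairs w → length w % 2 ≡ 0
Pairs-even []         = refl
Pairs-even (pair _ p) = Pairs-even p

Pairs⇔even×X′ : ∀ {w} → Pairs w ⇔ (length w % 2 ≡ 0 × X′ w)
Pairs⇔even×X′ = mk⇔ (λ p → Pairs-even p , pairs p) (λ (even , x′) → to x′ even)
  where
  to : ∀ {w} → X′ w → length w % 2 ≡ 0 → Pairs w
  to (pairs p)        _    = p
  to (middle c {w} p) even with trans (sym (suc-even (length w) (Pairs-even p))) even
  ... | ()
  to (pair x≢y x′)    even = pair x≢y (to x′ even)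

X′-pair : ∀ {x y w} → x ≢ y → X′ (x ∷ y ∷ w) ⇔ X′ w
X′-pair x≢y = mk⇔ to (pair x≢y)
  where
  to : X′ (_ ∷ _ ∷ _) → X′ _
  to (pairs (pair _ p))            = pairs p
  to (middle _ (pair {y = z} _ p)) = middle z p
  to (pair _ x′)                   = x′

X′-double : ∀ {x y w} → x ≢ y → X′ (x ∷ x ∷ y ∷ w) ⇔ Pairs w
X′-double {x} x≢y = mk⇔ to (λ p → middle x (pair x≢y p))
  where
  to : X′ (x ∷ x ∷ _ ∷ _) → Pairs _
  to (pairs (pair x≢x _))  = ⊥-elim (x≢x refl)
  to (middle _ (pair _ p)) = p
  to (pair x≢x _)          = ⊥-elim (x≢x refl)

¬X′-triple : ∀ {x u} → ¬ X′ (x ∷ x ∷ x ∷ u)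
¬X′-triple (pairs (pair x≢x _))    = x≢x refl
¬X′-triple (middle _ (pair x≢x _)) = x≢x refl
¬X′-triple (pair x≢x _)            = x≢x refl

AtUpperBound : Word → Set
AtUpperBound v = height v ≡ suc ⌊ length v /2⌋

AtUpperBound⇔X′-constant : ∀ {v} → Constant v → AtUpperBound v ⇔ X′ v
AtUpperBound⇔X′-constant {[]}        _ = mk⇔ (λ _ → pairs []) (λ _ → refl)
AtUpperBound⇔X′-constant {x ∷ []}    c = mk⇔ (λ _ → middle x []) (λ _ → height-constant c)
AtUpperBound⇔X′-constant {x ∷ _ ∷ u} c@(_ , refl ∷ refl ∷ u≡x) = mk⇔ to from
  where
  to : AtUpperBound (x ∷ x ∷ u) → X′ (x ∷ x ∷ u)
  to h≡ with trans (sym (height-constant c)) h≡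
  ... | ()
  from : X′ (x ∷ x ∷ u) → AtUpperBound (x ∷ x ∷ u)
  from x′ = ⊥-elim (¬X′ u u≡x x′)
    where
    ¬X′ : ∀ u → All (_≡ x) u → ¬ X′ (x ∷ x ∷ u)
    ¬X′ []      []         (pairs (pair x≢x _)) = x≢x refl
    ¬X′ []      []         (pair x≢x _)         = x≢x refl
    ¬X′ (_ ∷ _) (refl ∷ _)                      = ¬X′-triple

height-triple< : ∀ {x y} k {w} → x ≢ y → Descent w →
                 height (x ∷ x ∷ x ∷ replicate k x ++ y ∷ w)
                   < suc ⌊ length (x ∷ x ∷ x ∷ replicate k x ++ y ∷ w) /2⌋
height-triple< {x} {y} k {w} x≢y d = begin-strict
  height (x ∷ x ∷ x ∷ replicate k x ++ y ∷ w)   ≡⟨ height-peel (suc (suc k)) x≢y d ⟩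
  suc (height w)                                ≤⟨ s≤s (height-upper d) ⟩
  suc (suc ⌊ length w /2⌋)                      <⟨ n<1+n _ ⟩
  suc ⌊ suc (suc (suc (suc (length w)))) /2⌋    ≤⟨ s≤s (s≤s (⌊n/2⌋-mono (length-y∷w<peel k w))) ⟩
  suc ⌊ length (x ∷ x ∷ x ∷ replicate k x ++ y ∷ w) /2⌋ ∎
  where open ≤-Reasoning

AtUpperBound⇔X′ : ∀ {v} → Descent v → AtUpperBound v ⇔ X′ v
AtUpperBound⇔X′ (constant c) = AtUpperBound⇔X′-constant c
AtUpperBound⇔X′ (peel {x} {y} {w} zero x≢y d) = begin
  AtUpperBound (x ∷ y ∷ w) ∼⟨ suc-≡⇔ (height-peel 0 x≢y d) refl ⟩
  AtUpperBound w           ∼⟨ AtUpperBound⇔X′ d ⟩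
  X′ w                     ∼⟨ ⇔-sym (X′-pair x≢y) ⟩
  X′ (x ∷ y ∷ w)           ∎
  where open EquationalReasoning
AtUpperBound⇔X′ (peel {x} {y} {w} (suc zero) x≢y d) = begin
  AtUpperBound (x ∷ x ∷ y ∷ w)                ∼⟨ suc-≡⇔ (height-peel 1 x≢y d) refl ⟩
  height w ≡ suc ⌊ suc (length w) /2⌋         ∼⟨ ≡1+⌊1+n/2⌋⇔even (length w) (height-upper d) ⟩
  (length w % 2 ≡ 0 × AtUpperBound w)         ∼⟨ ⇔-id _ ×-⇔ AtUpperBound⇔X′ d ⟩
  (length w % 2 ≡ 0 × X′ w)                   ∼⟨ ⇔-sym Pairs⇔even×X′ ⟩
  Pairs w                                     ∼⟨ ⇔-sym (X′-double x≢y) ⟩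
  X′ (x ∷ x ∷ y ∷ w)                          ∎
  where open EquationalReasoning
AtUpperBound⇔X′ (peel (suc (suc k)) x≢y d) =
  mk⇔ (λ h≡ → ⊥-elim (<-irrefl h≡ (height-triple< k x≢y d))) (λ x′ → ⊥-elim (¬X′-triple x′))

Star-lett : ∀ {x s} → Star (lett x) s → ∃ λ k → s ≡ replicate k x
Star-lett nil            = 0 , refl
Star-lett (cons refl st) with Star-lett st
... | k , refl = suc k , refl

Plus-lett : ∀ {x u} → Plus (lett x) u → ∃ λ k → u ≡ x ∷ replicate k x
Plus-lett (_ , _ , refl , refl , st) with Star-lett st
... | k , refl = k , refl

Plus-lett-run : ∀ x k → Plus (lett x) (x ∷ replicate k x)
Plus-lett-run x k = x ∷ [] , replicate k x , refl , refl , Star-replicate k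
  where
  Star-replicate : ∀ k → Star (lett x) (replicate k x)
  Star-replicate zero    = nil
  Star-replicate (suc k) = cons refl (Star-replicate k)

module _ {x y : Letter} where

  LowOdd⇔LowOdd′ : ∀ {v} → LowOdd x y v ⇔ LowOdd′ x y v
  LowOdd⇔LowOdd′ = mk⇔ to from
    where
    to-Star : ∀ k {s} → Star (lett y · Plus (lett x)) s → LowOdd′ x y (x ∷ replicate k x ++ s)
    to-Star k nil = subst (λ u → LowOdd′ x y (x ∷ u)) (sym (++-identityʳ _)) (run k)
    to-Star k (cons (_ , _ , refl , refl , p) st) with Plus-lett p
    ... | j , refl = step k (to-Star j st)
    to : ∀ {v} → LowOdd x y v → LowOdd′ x y v
    to (_ , _ , refl , p , st) with Plus-lett p
    ... | k , refl = to-Star k st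
    from : ∀ {v} → LowOdd′ x y v → LowOdd x y v
    from (run k)    = x ∷ replicate k x , [] , sym (++-identityʳ _) , Plus-lett-run x k , nil
    from (step k o) with from o
    ... | u , s , refl , p , st =
      x ∷ replicate k x , (y ∷ u) ++ s , refl , Plus-lett-run x k , cons (y ∷ [] , u , refl , refl , p) st

  RunsThenRun : Word → Set
  RunsThenRun = Star (Plus (lett y) · lett x) · Plus (lett y)

  RunsThenRun⇔LowOdd′ : ∀ {q} → RunsThenRun q ⇔ LowOdd′ y x q
  RunsThenRun⇔LowOdd′ = mk⇔ (λ (_ , _ , eq , st , p) → subst (LowOdd′ y x) (sym eq) (to st p)) from
    where
    to : ∀ {s c} → Star (Plus (lett y) · lett x) s → Plus (lett y) c → LowOdd′ y x (s ++ c)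
    to nil p with Plus-lett p
    ... | j , refl = run j
    to {c = c} (cons {v = s} (_ , _ , refl , p , refl) st) q with Plus-lett p
    ... | j , refl =
      subst (λ u → LowOdd′ y x (y ∷ u)) (sym (++-∷ʳ-assoc (replicate j y) x s c)) (step j (to st q))
    from : ∀ {q} → LowOdd′ y x q → RunsThenRun q
    from (run j)    = [] , y ∷ replicate j y , refl , nil , Plus-lett-run y j
    from (step j o) with from o
    ... | s , c , refl , st , p =
      (y ∷ replicate j y ++ x ∷ []) ++ s , c , cong (y ∷_) (sym (++-∷ʳ-assoc (replicate j y) x s c)) ,
      cons (y ∷ replicate j y , x ∷ [] , refl , Plus-lett-run y j , refl) st , p

·-assoc : ∀ {L M N : Lang} {w} → ((L · M) · N) w ⇔ (L · (M · N)) w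
·-assoc = mk⇔
  (λ { (_ , r , refl , (p , q , refl , lp , mq) , nr) →
        p , q ++ r , ++-assoc p q r , lp , (q , r , refl , mq , nr) })
  (λ { (p , _ , refl , lp , (q , r , refl , mq , nr)) →
        p ++ q , r , sym (++-assoc p q r) , (p , q , refl , lp , mq) , nr })

·-cong : ∀ {L L′ M M′ : Lang} {w} →
         (∀ {u} → L u ⇔ L′ u) → (∀ {u} → M u ⇔ M′ u) → (L · M) w ⇔ (L′ · M′) w
·-cong L⇔L′ M⇔M′ = mk⇔
  (λ (p , q , eq , lp , mq) → p , q , eq , Equivalence.to L⇔L′ lp , Equivalence.to M⇔M′ mq)
  (λ (p , q , eq , lp , mq) → p , q , eq , Equivalence.from L⇔L′ lp , Equivalence.from M⇔M′ mq)

module _ {x y : Letter} where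

  LowEven′⇔LowOdd′·LowOdd′ : ∀ {v} → LowEven′ x y v ⇔ (LowOdd′ x y · LowOdd′ y x) v
  LowEven′⇔LowOdd′·LowOdd′ =
    mk⇔ to (λ (_ , _ , eq , o₁ , o₂) → subst (LowEven′ x y) (sym eq) (from o₁ o₂))
    where
    to : ∀ {v} → LowEven′ x y v → (LowOdd′ x y · LowOdd′ y x) v
    to (switch k o) = x ∷ replicate k x , _ , refl , run k , o
    to (step k e) with to e
    ... | u , q , refl , o₁ , o₂ =
      x ∷ replicate k x ++ y ∷ u , q , cong (x ∷_) (sym (++-assoc (replicate k x) (y ∷ u) q)) ,
      step k o₁ , o₂
    from : ∀ {u q} → LowOdd′ x y u → LowOdd′ y x q → LowEven′ x y (u ++ q)
    from (run k)         o₂ = switch k o₂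
    from (step k {w} o₁) o₂ =
      subst (LowEven′ x y) (cong (x ∷_) (sym (++-assoc (replicate k x) (y ∷ w) _))) (step k (from o₁ o₂))

  LowEven⇔ : ∀ {v} → LowEven x y v ⇔ (v ≡ [] ⊎ LowEven′ x y v)
  LowEven⇔ = ⇔-id _ ⊎-⇔ (⇔-sym LowEven′⇔LowOdd′·LowOdd′
                          ⇔-∘ (·-cong LowOdd⇔LowOdd′ RunsThenRun⇔LowOdd′ ⇔-∘ ·-assoc))

ABs⇔Pairs : ∀ {w} → ABs w ⇔ Pairs w
ABs⇔Pairs = mk⇔ to from
  where
  to : ∀ {w} → ABs w → Pairs w
  to nil                   = []
  to (cons (inj₁ refl) st) = pair (λ ()) (to st)
  to (cons (inj₂ refl) st) = pair (λ ()) (to st)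
  from : ∀ {w} → Pairs w → ABs w
  from []                   = nil
  from (pair {a} {a} a≢a _) = ⊥-elim (a≢a refl)
  from (pair {a} {b} _ p)   = cons (inj₁ refl) (from p)
  from (pair {b} {a} _ p)   = cons (inj₂ refl) (from p)
  from (pair {b} {b} b≢b _) = ⊥-elim (b≢b refl)

X⇔X′ : ∀ {v} → X v ⇔ X′ v
X⇔X′ = mk⇔ to from
  where
  X′-prefix : ∀ {p u} → Pairs p → X′ u → X′ (p ++ u)
  X′-prefix []           x′ = x′
  X′-prefix (pair x≢y p) x′ = pair x≢y (X′-prefix p x′)
  to : ∀ {v} → X v → X′ v
  to (_ , q , refl , (p , _ , refl , ap , m) , aq) =
    subst X′ (sym (++-assoc p _ q))
          (X′-prefix (Equivalence.to ABs⇔Pairs ap) (middle-to m (Equivalence.to ABs⇔Pairs aq)))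
    where
    middle-to : ∀ {m q} → (epsL ∪ (lett a ∪ lett b)) m → Pairs q → X′ (m ++ q)
    middle-to (inj₁ refl)        = pairs
    middle-to (inj₂ (inj₁ refl)) = middle a
    middle-to (inj₂ (inj₂ refl)) = middle b
  letter : ∀ c → (epsL ∪ (lett a ∪ lett b)) (c ∷ [])
  letter a = inj₂ (inj₁ refl)
  letter b = inj₂ (inj₂ refl)
  from : ∀ {v} → X′ v → X v
  from (pairs p)    = [] , _ , refl , ([] , [] , refl , nil , inj₁ refl) , Equivalence.from ABs⇔Pairs p
  from (middle c p) = c ∷ [] , _ , refl , ([] , c ∷ [] , refl , nil , letter c) , Equivalence.from ABs⇔Pairs p
  from (pair {x} {y} x≢y x′) with from x′
  ... | _ , q , refl , (p , m , refl , ap , mm) , aq =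
    x ∷ y ∷ p ++ m , q , refl ,
    (x ∷ y ∷ p , m , refl , Equivalence.from ABs⇔Pairs (pair x≢y (Equivalence.to ABs⇔Pairs ap)) , mm) , aq

LowerRegular : Word → Set
LowerRegular v = ∃₂ λ (x y : Letter) → x ≢ y ×
                   (((ext v % 2 ≡ 1) × LowOdd x y v) ⊎ ((ext v % 2 ≡ 0) × LowEven x y v))

Lower⇔LowerRegular : ∀ {v} → Lower v ⇔ LowerRegular v
Lower⇔LowerRegular = mk⇔ to from
  where
  to : ∀ {v} → Lower v → LowerRegular v
  to (inj₁ refl)                    = a , b , (λ ()) , inj₂ (refl , inj₁ refl)
  to (inj₂ (x , y , x≢y , inj₁ o)) =
    x , y , x≢y , inj₁ (LowOdd′-odd x≢y o , Equivalence.from LowOdd⇔LowOdd′ o)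
  to (inj₂ (x , y , x≢y , inj₂ e)) =
    x , y , x≢y , inj₂ (LowEven′-even x≢y e , Equivalence.from LowEven⇔ (inj₂ e))
  from : ∀ {v} → LowerRegular v → Lower v
  from (x , y , x≢y , inj₁ (_ , o)) = inj₂ (x , y , x≢y , inj₁ (Equivalence.to LowOdd⇔LowOdd′ o))
  from (x , y , x≢y , inj₂ (_ , e)) with Equivalence.to LowEven⇔ e
  ... | inj₁ v≡[] = inj₁ v≡[]
  ... | inj₂ e′   = inj₂ (x , y , x≢y , inj₂ e′)

mainTheorem15 : (v : Word) →
  ((⌊ ext v /2⌋ + 1 ≤ height v) × (height v ≤ ⌊ length v /2⌋ + 1))
  × ((height v ≡ ⌊ ext v /2⌋ + 1) ⇔
       (∃₂ λ (x y : Letter) → x ≢ y ×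
          (((ext v % 2 ≡ 1) × LowOdd x y v) ⊎ ((ext v % 2 ≡ 0) × LowEven x y v))))
  × ((height v ≡ ⌊ length v /2⌋ + 1) ⇔ X v)
mainTheorem15 v rewrite +-comm ⌊ ext v /2⌋ 1 | +-comm ⌊ length v /2⌋ 1 =
  (height-lower d , height-upper d) ,
  Lower⇔LowerRegular ⇔-∘ AtLowerBound⇔Lower d ,
  ⇔-sym X⇔X′ ⇔-∘ AtUpperBound⇔X′ d
  where
  d : Descent v
  d = descent v
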